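{- Let $d\ge 2$, let $1\le t<2d$ be an integer and let $A=(A_\bullet,A_\circ)$ be a $t$-approximation in $\mathbb{Z}^d$. Then every regular odd set $S$ approximated by $A$ satisfies \[ |A_*\cap\partial_{\bullet\circ}S| \le \frac{|\partial S|}{2d-t} .\]
   Context: $\mathbb{Z}^d$ is viewed as a graph with nearest-neighbor adjacency. A vertex is odd (even) if its graph distance from the origin is odd (even). $\partial S$ is the set of edges with exactly one endpoint in $S$. A set $U$ is odd (resp. even) if every vertex of $U$ adjacent to a vertex outside $U$ is odd (resp. even). A set is regular if neither it nor its complement contains a vertex all of whose neighbors lie outside it. $\partial_\bullet S$ is the set of vertices of $S$ adjacent to $S^c$, $\partial_\circ S$ the set of vertices of $S^c$ adjacent to $S$, and $\partial_{\bullet\circ}S:=\partial_\bullet S\cup\partial_\circ S$. An approximation is a pair $A=(A_\bullet,A_\circ)$ of disjoint subsets with $A_\bullet$ odd and $A_\circ$ even; $A_*:=(A_\bullet\cup A_\circ)^c$; $A$ approximates $S$ if $A_\bullet\subset S$ and $A_\circ\subset S^c$. A $t$-approximation is an approximation such that the subgraph induced by $A_*$ has maximum degree at most $t$ and no isolated vertices. -}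

module Defs where

open import Data.Nat using (ℕ; _≤_; _%_)
open import Data.Integer using (ℤ; ∣_∣; _-_)
open import Data.Vec using (Vec; sum; map; zipWith; replicate)
open import Data.Bool using (Bool; T)
open import Data.List using (List)
open import Data.List.Relation.Unary.All using (All)
open import Data.List.Relation.Unary.Unique.Propositional using (Unique)
open import Data.Product using (_×_; ∃; _,_)
open import Data.Sum using (_⊎_)
open import Relation.Nullary using (¬_)
open import Relation.Binary.PropositionalEquality using (_≡_)
import Data.List as L

V : ℕ → Set
V d = Vec ℤ d

-- ℓ¹ distance = graph distance in ℤ^d
dist : ∀ {d} → V d → V d → ℕ
dist u v = sum (zipWith (λ a b → ∣ a - b ∣) u v)

Adj : ∀ {d} → V d → V d → Set
Adj u v = dist u v ≡ 1

origin : ∀ {d} → V d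
origin = replicate _ (Data.Integer.+ 0)
  where import Data.Integer

OddV EvenV : ∀ {d} → V d → Set
OddV v = dist origin v % 2 ≡ 1
EvenV v = dist origin v % 2 ≡ 0

Sub : ℕ → Set
Sub d = V d → Bool

_∈_ : ∀ {d} → V d → Sub d → Set
v ∈ S = T (S v)

_∉_ : ∀ {d} → V d → Sub d → Set
v ∉ S = ¬ (v ∈ S)

OddSet EvenSet : ∀ {d} → Sub d → Set
OddSet U = ∀ u v → Adj u v → u ∈ U → v ∉ U → OddV u
EvenSet U = ∀ u v → Adj u v → u ∈ U → v ∉ U → EvenV u

Regular : ∀ {d} → Sub d → Set
Regular S = (∀ u → u ∈ S → ¬ (∀ v → Adj u v → v ∉ S))
          × (∀ u → u ∉ S → ¬ (∀ v → Adj u v → v ∈ S))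

BdryVO : ∀ {d} → Sub d → V d → Set
BdryVO S v = (v ∈ S × ∃ λ w → Adj v w × w ∉ S)
           ⊎ (v ∉ S × ∃ λ w → Adj v w × w ∈ S)

-- an edge of ∂S, represented (uniquely) by its ordered pair (inside, outside)
BEdge : ∀ {d} → Sub d → V d × V d → Set
BEdge S (u , v) = Adj u v × u ∈ S × v ∉ S

record Approx (d : ℕ) : Set where
  field
    Ablack Awhite : Sub d
    disjoint : ∀ v → ¬ (v ∈ Ablack × v ∈ Awhite)
    blackOdd : OddSet Ablack
    whiteEven : EvenSet Awhite

open Approx public

InStar : ∀ {d} → Approx d → V d → Set
InStar A v = v ∉ Ablack A × v ∉ Awhite A

IsTApprox : ∀ {d} → ℕ → Approx d → Set
IsTApprox {d} t A =
  (∀ v → InStar A v → (ns : List (V d)) → Unique ns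
     → All (λ w → Adj v w × InStar A w) ns → L.length ns ≤ t)
  × (∀ v → InStar A v → ∃ λ w → Adj v w × InStar A w)

Approximates : ∀ {d} → Approx d → Sub d → Set
Approximates A S = (∀ v → v ∈ Ablack A → v ∈ S) × (∀ v → v ∈ Awhite A → v ∉ S)

-- A vertex v of A_* on the boundary of S has at most t neighbours in A_*, hence at least
-- 2d − t neighbours in A_• ∪ A_∘, and every such neighbour w lies on the other side of S:
-- if v ∈ S then v is odd (S is odd), so w is even and cannot be in the odd set A_•; thus
-- w ∈ A_∘ ⊆ Sᶜ. If v ∉ S then v is even (its neighbour in S is odd), so w cannot be in
-- the even set A_∘; thus w ∈ A_• ⊆ S. Each such edge vw has exactly one endpoint in A_*,
-- so the edges collected at distinct vertices of A_* ∩ ∂_{•∘}S are distinct.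
module Submission where

open import Defs
open import Data.Bool using (Bool; true; false; T)
open import Data.Bool.Properties using (T?)
open import Data.Empty using (⊥; ⊥-elim)
open import Data.Integer as ℤ using (+_; -[1+_]; ∣_∣; _-_; 0ℤ; 1ℤ; -1ℤ)
import Data.Integer.Properties as ℤ
open import Data.Integer.Tactic.RingSolver using (solve-∀)
open import Data.List using (List; []; _∷_; length; map; filter; concatMap)
open import Data.List.Properties using (length-map; length-++)
open import Data.List.Membership.Propositional using (find) renaming (_∈_ to _∈ₗ_)
open import Data.List.Membership.Propositional.Properties using (∈-map⁻; ∈-filter⁻; ∈-concatMap⁻)
open import Data.List.Relation.Unary.All as All using (All; []; _∷_)
import Data.List.Relation.Unary.All.Properties as All
open import Data.List.Relation.Unary.AllPairs using ([]; _∷_)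
open import Data.List.Relation.Unary.Any using (here; there)
open import Data.List.Relation.Unary.Unique.Propositional using (Unique)
import Data.List.Relation.Unary.Unique.Propositional.Properties as Unique
open import Data.Nat using (ℕ; zero; suc; _+_; _*_; _∸_; _≤_; _<_; _%_)
open import Data.Nat.Properties
open import Data.Product using (_×_; _,_; ∃; proj₁; proj₂)
open import Data.Sum using (_⊎_; inj₁; inj₂; [_,_])
open import Data.Vec using ([]; _∷_)
open import Data.Vec.Properties using (∷-injectiveˡ; ∷-injectiveʳ)
open import Function using (_∘_; case_of_)
open import Relation.Nullary using (¬_; ¬?; yes; no)
open import Relation.Nullary.Decidable using (_⊎-dec_)
open import Relation.Unary using (Pred; Decidable)
open import Relation.Binary.PropositionalEquality hiding ([_])

private
  variable
    d : ℕ
    u v w : V d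

module _ {a p} {X : Set a} {P : Pred X p} where

  length-filter-+-filter-¬ : (P? : Decidable P) (xs : List X) →
    length (filter P? xs) + length (filter (¬? ∘ P?) xs) ≡ length xs
  length-filter-+-filter-¬ P? [] = refl
  length-filter-+-filter-¬ P? (x ∷ xs) with P? x
  ... | yes _ = cong suc (length-filter-+-filter-¬ P? xs)
  ... | no _ =
    trans (+-suc _ _) (cong suc (length-filter-+-filter-¬ P? xs))

  module _ {b} {Y : Set b} {f : X → List Y} where

    concatMap-unique : (∀ {x} → P x → Unique (f x)) →
      (∀ {x x′ y} → P x → P x′ → y ∈ₗ f x → y ∈ₗ f x′ → x ≡ x′) →
      ∀ {xs} → Unique xs → All P xs → Unique (concatMap f xs)
    concatMap-unique uniq owner [] [] = []
    concatMap-unique uniq owner (x∉xs ∷ !xs) (px ∷ pxs) =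
      Unique.++⁺ (uniq px) (concatMap-unique uniq owner !xs pxs) λ (y∈fx , y∈rest) →
        let x′ , x′∈xs , y∈fx′ = find (∈-concatMap⁻ f y∈rest) in
        All.lookup x∉xs x′∈xs (owner px (All.lookup pxs x′∈xs) y∈fx y∈fx′)

    concatMap-length : ∀ {k} → (∀ {x} → P x → k ≤ length (f x)) →
      ∀ {xs} → All P xs → k * length xs ≤ length (concatMap f xs)
    concatMap-length {k} long [] = ≤-reflexive (*-zeroʳ k)
    concatMap-length {k} long {x ∷ xs} (px ∷ pxs) = begin
      k * suc (length xs)                ≡⟨ *-suc k (length xs) ⟩
      k + k * length xs                  ≤⟨ +-mono-≤ (long px) (concatMap-length long pxs) ⟩
      length (f x) + length (concatMap f xs) ≡⟨ length-++ (f x) ⟨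
      length (concatMap f (x ∷ xs))      ∎
      where open ≤-Reasoning

orient : ∀ {a} {X : Set a} → Bool → X → X → X × X
orient true x y = x , y
orient false x y = y , x

orient-injectiveʳ : ∀ {a} {X : Set a} b (x : X) {y y′} → orient b x y ≡ orient b x y′ → y ≡ y′
orient-injectiveʳ true x eq = cong proj₂ eq
orient-injectiveʳ false x eq = cong proj₁ eq

OneApart : ℕ → ℕ → Set
OneApart m n = m ≡ suc n ⊎ n ≡ suc m

OneApart-+ˡ : ∀ k {m n} → OneApart m n → OneApart (k + m) (k + n)
OneApart-+ˡ k {n = n} (inj₁ refl) = inj₁ (+-suc k n)
OneApart-+ˡ k {m = m} (inj₂ refl) = inj₂ (+-suc k m)

OneApart-+ʳ : ∀ k {m n} → OneApart m n → OneApart (m + k) (n + k)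
OneApart-+ʳ k (inj₁ refl) = inj₁ refl
OneApart-+ʳ k (inj₂ refl) = inj₂ refl

suc-%2-+-%2 : ∀ n → suc n % 2 + n % 2 ≡ 1
suc-%2-+-%2 zero = refl
suc-%2-+-%2 (suc n) = trans (+-comm (n % 2) (suc n % 2)) (suc-%2-+-%2 n)

OneApart⇒%2-+-%2 : ∀ {m n} → OneApart m n → m % 2 + n % 2 ≡ 1
OneApart⇒%2-+-%2 {n = n} (inj₁ refl) = suc-%2-+-%2 n
OneApart⇒%2-+-%2 {m = m} (inj₂ refl) = trans (+-comm (m % 2) _) (suc-%2-+-%2 m)

i-[i-j]≡j : ∀ i j → i - (i - j) ≡ j
i-[i-j]≡j = solve-∀

i-j≡i-k⇒j≡k : ∀ i {j k} → i - j ≡ i - k → j ≡ k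
i-j≡i-k⇒j≡k i {j} {k} eq = trans (sym (i-[i-j]≡j i j)) (trans (cong (i -_) eq) (i-[i-j]≡j i k))

∣i∣≡1⇒i≡±1 : ∀ {i} → ∣ i ∣ ≡ 1 → i ≡ 1ℤ ⊎ i ≡ -1ℤ
∣i∣≡1⇒i≡±1 {+ 1} refl = inj₁ refl
∣i∣≡1⇒i≡±1 { -[1+ 0 ]} refl = inj₂ refl

OneApart-∣i-1∣ : ∀ i → OneApart ∣ i - 1ℤ ∣ ∣ i ∣
OneApart-∣i-1∣ (+ zero) = inj₁ refl
OneApart-∣i-1∣ (+ suc n) = inj₂ refl
OneApart-∣i-1∣ -[1+ n ] = inj₁ (cong (suc ∘ suc) (+-identityʳ n))

OneApart-∣i+1∣ : ∀ i → OneApart ∣ i - -1ℤ ∣ ∣ i ∣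
OneApart-∣i+1∣ (+ n) = inj₁ (+-comm n 1)
OneApart-∣i+1∣ -[1+ zero ] = inj₂ refl
OneApart-∣i+1∣ -[1+ suc n ] = inj₂ refl

OneApart-∣i-δ∣ : ∀ i {δ} → δ ≡ 1ℤ ⊎ δ ≡ -1ℤ → OneApart ∣ i - δ ∣ ∣ i ∣
OneApart-∣i-δ∣ i (inj₁ refl) = OneApart-∣i-1∣ i
OneApart-∣i-δ∣ i (inj₂ refl) = OneApart-∣i+1∣ i

∣i-j∣≡1⇒OneApart : ∀ i j → ∣ i - j ∣ ≡ 1 → OneApart ∣ j ∣ ∣ i ∣
∣i-j∣≡1⇒OneApart i j ∣i-j∣≡1 = subst (λ k → OneApart ∣ k ∣ ∣ i ∣) (i-[i-j]≡j i j)
  (OneApart-∣i-δ∣ i (∣i∣≡1⇒i≡±1 ∣i-j∣≡1))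

‖_‖ : V d → ℕ
‖ v ‖ = dist origin v

‖∷‖ : ∀ x (v : V d) → ‖ x ∷ v ‖ ≡ ∣ x ∣ + ‖ v ‖
‖∷‖ x v = cong (_+ ‖ v ‖) (trans (cong ∣_∣ (ℤ.+-identityˡ (ℤ.- x))) (ℤ.∣-i∣≡∣i∣ x))

dist-refl : ∀ (v : V d) → dist v v ≡ 0
dist-refl [] = refl
dist-refl (x ∷ v) = cong₂ _+_ (cong ∣_∣ (ℤ.+-inverseʳ x)) (dist-refl v)

dist-sym : ∀ (u v : V d) → dist u v ≡ dist v u
dist-sym [] [] = refl
dist-sym (x ∷ u) (y ∷ v) = cong₂ _+_ (ℤ.∣i-j∣≡∣j-i∣ x y) (dist-sym u v)

dist≡0⇒≡ : ∀ (u v : V d) → dist u v ≡ 0 → u ≡ v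
dist≡0⇒≡ [] [] _ = refl
dist≡0⇒≡ (x ∷ u) (y ∷ v) eq = cong₂ _∷_
  (ℤ.i-j≡0⇒i≡j x y (ℤ.∣i∣≡0⇒i≡0 (m+n≡0⇒m≡0 ∣ x - y ∣ eq)))
  (dist≡0⇒≡ u v (m+n≡0⇒n≡0 ∣ x - y ∣ eq))

Adj-sym : Adj u v → Adj v u
Adj-sym {u = u} {v} a = trans (dist-sym v u) a

Adj⇒OneApart : ∀ (u v : V d) → Adj u v → OneApart ‖ v ‖ ‖ u ‖
Adj⇒OneApart [] [] ()
Adj⇒OneApart (x ∷ u) (y ∷ v) a with ∣ x - y ∣ in eq
... | 0 rewrite ℤ.i-j≡0⇒i≡j x y (ℤ.∣i∣≡0⇒i≡0 eq) =
  subst₂ OneApart (sym (‖∷‖ y v)) (sym (‖∷‖ y u)) (OneApart-+ˡ ∣ y ∣ (Adj⇒OneApart u v a))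
... | 1 rewrite dist≡0⇒≡ u v (suc-injective a) =
  subst₂ OneApart (sym (‖∷‖ y v)) (sym (‖∷‖ x v)) (OneApart-+ʳ ‖ v ‖ (∣i-j∣≡1⇒OneApart x y eq))

Adj⇒%2-+-%2 : Adj u v → ‖ u ‖ % 2 + ‖ v ‖ % 2 ≡ 1
Adj⇒%2-+-%2 {u = u} {v} a = OneApart⇒%2-+-%2 (Adj⇒OneApart v u (Adj-sym {u = u} a))

odd-neighbour-even : Adj u v → OddV u → EvenV v
odd-neighbour-even {u = u} {v} a odd = suc-injective (subst (λ p → p + ‖ v ‖ % 2 ≡ 1) odd (Adj⇒%2-+-%2 {u = u} a))

even-neighbour-odd : Adj u v → EvenV u → OddV v
even-neighbour-odd {u = u} {v} a even = subst (λ p → p + ‖ v ‖ % 2 ≡ 1) even (Adj⇒%2-+-%2 {u = u} a)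

parity-clash : EvenV v → OddV v → ⊥
parity-clash even odd with trans (sym even) odd
... | ()

-- Shifts are written x - δ with δ = ±1, so that adjacency and distinctness of the
-- neighbours both come down to x - (x - δ) ≡ δ.
neighbours : V d → List (V d)
neighbours [] = []
neighbours (x ∷ v) = (x - 1ℤ ∷ v) ∷ (x - -1ℤ ∷ v) ∷ map (x ∷_) (neighbours v)

length-neighbours : ∀ (v : V d) → length (neighbours v) ≡ 2 * d
length-neighbours [] = refl
length-neighbours {suc d} (x ∷ v) = begin
  2 + length (map (x ∷_) (neighbours v)) ≡⟨ cong (suc ∘ suc) (length-map (x ∷_) (neighbours v)) ⟩
  2 + length (neighbours v)             ≡⟨ cong (suc ∘ suc) (length-neighbours v) ⟩
  2 + 2 * d                             ≡⟨ *-suc 2 d ⟨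
  2 * suc d                             ∎
  where open ≡-Reasoning

neighbours-unique : ∀ (v : V d) → Unique (neighbours v)
neighbours-unique [] = []
neighbours-unique (x ∷ v) =
  ((λ eq → case i-j≡i-k⇒j≡k x {1ℤ} { -1ℤ} (∷-injectiveˡ eq) of λ ()) ∷ off-axis 1ℤ (λ ()))
  ∷ off-axis -1ℤ (λ ())
  ∷ Unique.map⁺ ∷-injectiveʳ (neighbours-unique v)
  where
  off-axis : ∀ δ → δ ≢ 0ℤ → All ((x - δ ∷ v) ≢_) (map (x ∷_) (neighbours v))
  off-axis δ δ≢0 = All.map⁺ (All.universal
    (λ w eq → δ≢0 (i-j≡i-k⇒j≡k x (trans (∷-injectiveˡ eq) (sym (ℤ.+-identityʳ x))))) _)

∈-neighbours⇒Adj : w ∈ₗ neighbours v → Adj v w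
∈-neighbours⇒Adj {v = x ∷ v} (here refl) = cong₂ _+_ (cong ∣_∣ (i-[i-j]≡j x 1ℤ)) (dist-refl v)
∈-neighbours⇒Adj {v = x ∷ v} (there (here refl)) = cong₂ _+_ (cong ∣_∣ (i-[i-j]≡j x -1ℤ)) (dist-refl v)
∈-neighbours⇒Adj {v = x ∷ v} (there (there w∈)) with ∈-map⁻ (x ∷_) w∈
... | _ , w′∈ , refl = cong₂ _+_ (cong ∣_∣ (ℤ.+-inverseʳ x)) (∈-neighbours⇒Adj w′∈)

module _ (A : Approx d) where

  Outside : V d → Set
  Outside w = w ∈ Ablack A ⊎ w ∈ Awhite A

  Outside? : Decidable Outside
  Outside? w = T? (Ablack A w) ⊎-dec T? (Awhite A w)

  InStar⇒¬Outside : InStar A w → ¬ Outside w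
  InStar⇒¬Outside (∉A• , ∉A∘) = [ ∉A• , ∉A∘ ]

  ¬Outside⇒InStar : ¬ Outside w → InStar A w
  ¬Outside⇒InStar ¬out = ¬out ∘ inj₁ , ¬out ∘ inj₂

  outerNeighbours : V d → List (V d)
  outerNeighbours v = filter Outside? (neighbours v)

  length-outerNeighbours : ∀ {t} → IsTApprox t A → InStar A v →
    2 * d ∸ t ≤ length (outerNeighbours v)
  length-outerNeighbours {v = v} {t} (maxDegree , _) v∈A* = begin
    2 * d ∸ t                                  ≤⟨ ∸-monoʳ-≤ (2 * d) inner≤t ⟩
    2 * d ∸ length inner                       ≡⟨ cong (_∸ length inner) partition ⟨
    length (outerNeighbours v) + length inner ∸ length inner ≡⟨ m+n∸n≡m _ (length inner) ⟩
    length (outerNeighbours v)                 ∎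
    where
    open ≤-Reasoning
    inner : List (V d)
    inner = filter (¬? ∘ Outside?) (neighbours v)
    partition : length (outerNeighbours v) + length inner ≡ 2 * d
    partition = trans (length-filter-+-filter-¬ Outside? (neighbours v)) (length-neighbours v)
    inner≤t : length inner ≤ t
    inner≤t = maxDegree v v∈A* inner (Unique.filter⁺ _ (neighbours-unique v))
      (All.tabulate λ w∈ → let w∈N , ¬out = ∈-filter⁻ (¬? ∘ Outside?) w∈
                           in ∈-neighbours⇒Adj {v = v} w∈N , ¬Outside⇒InStar ¬out)

  orient-owner : ∀ {v v′ w w′} b b′ → InStar A v → InStar A v′ → Outside w → Outside w′ →
    orient b v w ≡ orient b′ v′ w′ → v ≡ v′
  orient-owner true true _ _ _ _ eq = cong proj₁ eq
  orient-owner false false _ _ _ _ eq = cong proj₂ eq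
  orient-owner true false v∈A* _ _ w′-out refl = ⊥-elim (InStar⇒¬Outside v∈A* w′-out)
  orient-owner false true _ v′∈A* w-out _ refl = ⊥-elim (InStar⇒¬Outside v′∈A* w-out)

module BoundaryEdges (A : Approx d) (S : Sub d) (oddS : OddSet S) (A≈S : Approximates A S) where

  crossing-from-inside : InStar A v → v ∈ S → (∃ λ w₀ → Adj v w₀ × w₀ ∉ S) →
    Adj v w → Outside A w → w ∉ S
  crossing-from-inside {v = v} {w} (v∉A• , _) v∈S (w₀ , a₀ , w₀∉S) a (inj₁ w∈A•) =
    ⊥-elim (parity-clash {v = w} (odd-neighbour-even {u = v} {w} a (oddS v w₀ a₀ v∈S w₀∉S))
                                 (blackOdd A w v (Adj-sym {u = v} {w} a) w∈A• v∉A•))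
  crossing-from-inside _ _ _ _ (inj₂ w∈A∘) = proj₂ A≈S _ w∈A∘

  crossing-from-outside : InStar A v → v ∉ S → (∃ λ w₀ → Adj v w₀ × w₀ ∈ S) →
    Adj v w → Outside A w → w ∈ S
  crossing-from-outside _ _ _ _ (inj₁ w∈A•) = proj₁ A≈S _ w∈A•
  crossing-from-outside {v = v} {w} (_ , v∉A∘) v∉S (w₀ , a₀ , w₀∈S) a (inj₂ w∈A∘) =
    ⊥-elim (parity-clash {v = w} (whiteEven A w v (Adj-sym {u = v} {w} a) w∈A∘ v∉A∘)
                                 (even-neighbour-odd {u = v} {w} a v-even))
    where
    w₀~v : Adj w₀ v
    w₀~v = Adj-sym {u = v} {w₀} a₀
    v-even : EvenV v
    v-even = odd-neighbour-even {u = w₀} {v} w₀~v (oddS w₀ v w₀~v w₀∈S v∉S)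

  orient-BEdge : ∀ b → S v ≡ b → InStar A v → BdryVO S v → Adj v w → Outside A w →
    BEdge S (orient b v w)
  orient-BEdge true _ v∈A* (inj₁ (v∈S , w₀)) a out =
    a , v∈S , crossing-from-inside v∈A* v∈S w₀ a out
  orient-BEdge {v = v} {w} false _ v∈A* (inj₂ (v∉S , w₀)) a out =
    Adj-sym {u = v} {w} a , crossing-from-outside v∈A* v∉S w₀ a out , v∉S
  orient-BEdge true Sv≡true _ (inj₂ (v∉S , _)) _ _ = ⊥-elim (v∉S (subst T (sym Sv≡true) _))
  orient-BEdge false Sv≡false _ (inj₁ (v∈S , _)) _ _ = ⊥-elim (subst T Sv≡false v∈S)

  boundaryEdges : V d → List (V d × V d)
  boundaryEdges v = map (orient (S v) v) (outerNeighbours A v)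

  ∈-boundaryEdges⁻ : ∀ {e} → e ∈ₗ boundaryEdges v →
    ∃ λ w → Adj v w × Outside A w × e ≡ orient (S v) v w
  ∈-boundaryEdges⁻ {v = v} e∈ with ∈-map⁻ (orient (S v) v) e∈
  ... | w , w∈ , refl = let w∈N , out = ∈-filter⁻ (Outside? A) w∈ in
                        w , ∈-neighbours⇒Adj {v = v} w∈N , out , refl

  boundaryEdges-unique : ∀ v → Unique (boundaryEdges v)
  boundaryEdges-unique v = Unique.map⁺ (orient-injectiveʳ (S v) v)
    (Unique.filter⁺ (Outside? A) (neighbours-unique v))

  boundaryEdges-owner : ∀ {v v′ e} → InStar A v → InStar A v′ →
    e ∈ₗ boundaryEdges v → e ∈ₗ boundaryEdges v′ → v ≡ v′
  boundaryEdges-owner {v} {v′} v∈A* v′∈A* e∈ e∈′ with ∈-boundaryEdges⁻ e∈ | ∈-boundaryEdges⁻ e∈′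
  ... | _ , _ , out , refl | _ , _ , out′ , eq =
    orient-owner A (S v) (S v′) v∈A* v′∈A* out out′ eq

  boundaryEdges-cross : InStar A v → BdryVO S v → All (BEdge S) (boundaryEdges v)
  boundaryEdges-cross {v = v} v∈A* bd = All.tabulate cross
    where
    cross : ∀ {e} → e ∈ₗ boundaryEdges v → BEdge S e
    cross e∈ with ∈-boundaryEdges⁻ e∈
    ... | _ , a , out , refl = orient-BEdge (S v) refl v∈A* bd a out

  boundaryEdges-length : ∀ {t} → IsTApprox t A → InStar A v →
    2 * d ∸ t ≤ length (boundaryEdges v)
  boundaryEdges-length {v = v} tA v∈A* = subst (_ ≤_) (sym (length-map _ (outerNeighbours A v)))
    (length-outerNeighbours A tA v∈A*)

lemma5p3 : (d : ℕ) → 2 ≤ d → (t : ℕ) → 1 ≤ t → t < 2 * d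
    → (A : Approx d) → IsTApprox t A
    → (S : Sub d) → OddSet S → Regular S → Approximates A S
    → (Ls : List (V d)) → Unique Ls → All (λ v → InStar A v × BdryVO S v) Ls
    → ∃ λ (E : List (V d × V d)) → Unique E × All (BEdge S) E
    × (2 * d ∸ t) * length Ls ≤ length E
lemma5p3 d _ t _ _ A tA S oddS _ A≈S Ls !Ls good =
  concatMap boundaryEdges Ls ,
  concatMap-unique (λ {v} _ → boundaryEdges-unique v)
    (λ (v∈A* , _) (v′∈A* , _) → boundaryEdges-owner v∈A* v′∈A*) !Ls good ,
  All.concat⁺ (All.map⁺ (All.map (λ (v∈A* , bd) → boundaryEdges-cross v∈A* bd) good)) ,
  concatMap-length (λ (v∈A* , _) → boundaryEdges-length tA v∈A*) good
  where open BoundaryEdges A S oddS A≈S
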